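{- For each positive integer $k$, let $w_k$ be the optimal value of the linear program: maximize $\sum_{j=1}^k\alpha_j$ subject to $f+\sum_{j=1}^k d_j\le1$; $\alpha_j\le\alpha_{j+1}$ ($1\le j<k$); $\alpha_j\le 3\alpha_l+3d_j+3d_l$ ($1\le j,l\le k$); $x_{jl}\ge\alpha_j-d_l$ ($1\le j\le l\le k$); $\sum_{l=j}^k x_{jl}\le f$ ($1\le j\le k$); $\alpha_j,d_j,f,x_{jl}\ge0$ ($1\le j\le l\le k$). Then $\sup_{k\ge1}w_k\ge 3.220$. -}

module Defs where

open import Data.Nat using (ℕ; zero; suc)
open import Data.Integer using (+_)
open import Data.Fin using (Fin; zero; suc; inject₁; _≤?_)
open import Data.Rational using (ℚ; _+_; _*_; _-_; _≤_; _<_; 0ℚ; 1ℚ; _/_)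
open import Data.Product using (_×_)
open import Relation.Nullary.Decidable using (⌊_⌋)
open import Data.Bool using (if_then_else_)

sumFin : ∀ {n} → (Fin n → ℚ) → ℚ
sumFin {zero}  g = 0ℚ
sumFin {suc n} g = g zero + sumFin (λ i → g (suc i))

3ℚ : ℚ
3ℚ = + 3 / 1

c3220 : ℚ
c3220 = + 161 / 50

-- Feasibility for the LP with k = suc m (indices 1..k ↦ Fin k, 0-based).
-- x j l is only constrained/used for j ≤ l.
Feasible : (m : ℕ) → (α d : Fin (suc m) → ℚ) → (f : ℚ)
         → (x : Fin (suc m) → Fin (suc m) → ℚ) → Set
Feasible m α d f x =
    (f + sumFin d ≤ 1ℚ)
  × (∀ (j : Fin m) → α (inject₁ j) ≤ α (suc j))
  × (∀ j l → α j ≤ 3ℚ * α l + 3ℚ * d j + 3ℚ * d l)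
  × (∀ j l → ⌊ j ≤? l ⌋ ≡T → α j - d l ≤ x j l)
  × (∀ j → sumFin (λ l → if ⌊ j ≤? l ⌋ then x j l else 0ℚ) ≤ f)
  × (∀ j → 0ℚ ≤ α j)
  × (∀ j → 0ℚ ≤ d j)
  × (0ℚ ≤ f)
  × (∀ j l → ⌊ j ≤? l ⌋ ≡T → 0ℚ ≤ x j l)
  where
  open import Relation.Binary.PropositionalEquality using (_≡_)
  open import Data.Bool using (Bool; true)
  _≡T : Bool → Set
  b ≡T = b ≡ true

-- The witness has k = 700 and all its variables are integers over the common denominator 10¹²,
-- so every constraint of the linear program becomes an inequality between natural numbers that
-- is decided by evaluation, and the objective comes out at least 3.220. Taking
-- x_{jl} = (α_j − d_l)⁺ meets the lower bounds on x with equality, and the k² constraints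
-- α_j ≤ 3α_l + 3d_j + 3d_l all follow from the k inequalities α_j ≤ 3μ + 3d_j for a single
-- number μ ≤ min_l (α_l + d_l).
module Submission where

open import Defs
open import Data.Nat using (ℕ)
open import Data.Fin using (Fin)
open import Data.Rational using (ℚ; _<_; _≤_; _-_; 0ℚ)
open import Data.Product using (Σ; _×_)

import Data.Nat as ℕ
import Data.Nat.Properties as ℕ
open import Data.Nat.Tactic.RingSolver using (solve-∀)
open import Data.Integer as ℤ using (+_)
import Data.Integer.Properties as ℤ
open import Data.Rational using (_+_; _*_; -_; 1ℚ; _/_; toℚᵘ)
open import Data.Rational.Properties
  using (toℚᵘ-injective; toℚᵘ-fromℚᵘ; toℚᵘ-homo-+; toℚᵘ-homo-*; toℚᵘ-cancel-≤; 0/n≡0;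
         +-0-group; +-identityʳ; +-monoˡ-≤; +-monoʳ-≤; neg-antimono-≤; <⇒≤; ≤-trans; ≤-reflexive; module ≤-Reasoning)
open import Data.Rational.Unnormalised as ℚᵘ using (*≤*) renaming (_/_ to _/ᵘ_; _≃_ to _≃ᵘ_)
import Data.Rational.Unnormalised.Properties as ℚᵘ
open import Algebra.Properties.Group +-0-group using (//-rightDividesʳ)
open import Data.Fin using (zero; suc; inject₁; _≤?_)
open import Data.Vec using (Vec; []; _∷_; lookup; tabulate; map; sum)
open import Data.Vec.Properties using (tabulate-cong; tabulate-∘; tabulate∘lookup)
open import Data.Vec.Relation.Unary.Linked using (Linked; _∷_; linked?)
open import Data.Vec.Relation.Binary.Pointwise.Inductive as Pointwise using (Pointwise)
open import Data.Bool using (true; false; if_then_else_)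
open import Data.Product using (_,_)
open import Data.Unit using (⊤; tt)
open import Function using (_∘_)
open import Relation.Binary.PropositionalEquality
open import Relation.Nullary using (Dec; yes; no; _×-dec_)
open import Relation.Nullary.Decidable using (⌊_⌋; isYes≗does; dec-true; dec-false; from-yes)

toℚᵘ-/ : ∀ i n → toℚᵘ (i / ℕ.suc n) ≃ᵘ i /ᵘ ℕ.suc n
toℚᵘ-/ i n = toℚᵘ-fromℚᵘ (ℚᵘ.mkℚᵘ i n)

/-distribʳ-+ : ∀ i j n → (i ℤ.+ j) / ℕ.suc n ≡ i / ℕ.suc n + j / ℕ.suc n
/-distribʳ-+ i j n = toℚᵘ-injective (begin
  toℚᵘ ((i ℤ.+ j) / D)               ≈⟨ toℚᵘ-/ (i ℤ.+ j) n ⟩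
  (i ℤ.+ j) /ᵘ D                      ≈⟨ ℚᵘ.*-cancelʳ-/ D ⟨
  ((i ℤ.+ j) ℤ.* + D) /ᵘ (D ℕ.* D)    ≡⟨ cong (_/ᵘ (D ℕ.* D)) (ℤ.*-distribʳ-+ (+ D) i j) ⟩
  i /ᵘ D ℚᵘ.+ j /ᵘ D                  ≈⟨ ℚᵘ.+-cong (toℚᵘ-/ i n) (toℚᵘ-/ j n) ⟨
  toℚᵘ (i / D) ℚᵘ.+ toℚᵘ (j / D)      ≈⟨ toℚᵘ-homo-+ (i / D) (j / D) ⟨
  toℚᵘ (i / D + j / D)                ∎)
  where
  D = ℕ.suc n
  open ℚᵘ.≃-Reasoning

/1-*-/ : ∀ i j n → (i / 1) * (j / ℕ.suc n) ≡ (i ℤ.* j) / ℕ.suc n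
/1-*-/ i j n = toℚᵘ-injective (begin
  toℚᵘ (i / 1 * (j / D))              ≈⟨ toℚᵘ-homo-* (i / 1) (j / D) ⟩
  toℚᵘ (i / 1) ℚᵘ.* toℚᵘ (j / D)      ≈⟨ ℚᵘ.*-cong (toℚᵘ-/ i 0) (toℚᵘ-/ j n) ⟩
  (i ℤ.* j) /ᵘ (1 ℕ.* D)              ≡⟨ ℚᵘ./-cong refl (ℕ.*-identityˡ D) ⟩
  (i ℤ.* j) /ᵘ D                      ≈⟨ toℚᵘ-/ (i ℤ.* j) n ⟨
  toℚᵘ ((i ℤ.* j) / D)                ∎)
  where
  D = ℕ.suc n
  open ℚᵘ.≃-Reasoning

/-mono-≤ : ∀ {a b} m n → a ℕ.* ℕ.suc n ℕ.≤ b ℕ.* ℕ.suc m → + a / ℕ.suc m ≤ + b / ℕ.suc n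
/-mono-≤ {a} {b} m n a*n≤b*m = toℚᵘ-cancel-≤
  (ℚᵘ.≤-respˡ-≃ (ℚᵘ.≃-sym (toℚᵘ-/ (+ a) m)) (ℚᵘ.≤-respʳ-≃ (ℚᵘ.≃-sym (toℚᵘ-/ (+ b) n))
    (*≤* (subst₂ ℤ._≤_ (ℤ.pos-* a _) (ℤ.pos-* b _) (ℤ.+≤+ a*n≤b*m)))))

p-q≤p : ∀ p {q} → 0ℚ ≤ q → p - q ≤ p
p-q≤p p 0≤q = ≤-trans (+-monoʳ-≤ p (neg-antimono-≤ 0≤q)) (≤-reflexive (+-identityʳ p))

linked-lookup : ∀ {a r} {A : Set a} {R : A → A → Set r} {m} {v : Vec A (ℕ.suc m)} →
                Linked R v → ∀ (j : Fin m) → R (lookup v (inject₁ j)) (lookup v (suc j))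
linked-lookup {v = _ ∷ _ ∷ _} (r ∷ _)  zero    = r
linked-lookup {v = _ ∷ _ ∷ _} (_ ∷ rs) (suc j) = linked-lookup rs j

suc≤?suc : ∀ {m n} (i : Fin m) (j : Fin n) → ⌊ suc i ≤? suc j ⌋ ≡ ⌊ i ≤? j ⌋
suc≤?suc i j with i ≤? j
... | yes i≤j = trans (isYes≗does (suc i ≤? suc j)) (dec-true (suc i ≤? suc j) (ℕ.s≤s i≤j))
... | no  i≰j = trans (isYes≗does (suc i ≤? suc j)) (dec-false (suc i ≤? suc j) (i≰j ∘ ℕ.s≤s⁻¹))

sumFrom : ∀ {n} → Fin n → (Fin n → ℕ) → ℕ
sumFrom j g = sum (tabulate λ l → if ⌊ j ≤? l ⌋ then g l else 0)

sumFrom-suc : ∀ {n} (j : Fin n) (g : Fin (ℕ.suc n) → ℕ) → sumFrom (suc j) g ≡ sumFrom j (g ∘ suc)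
sumFrom-suc j g = cong sum (tabulate-cong λ l → cong (if_then g (suc l) else 0) (suc≤?suc j l))

-- Row j of the constraint, Σ_{l ≥ j} (a_j ∸ d_l) ≤ f, read off the suffixes of the two vectors,
-- which makes deciding all rows quadratic rather than cubic in the length.
RowSums≤ : ∀ {n} → ℕ → Vec ℕ n → Vec ℕ n → Set
RowSums≤ f []       []       = ⊤
RowSums≤ f (a ∷ as) (d ∷ ds) = sum (map (a ℕ.∸_) (d ∷ ds)) ℕ.≤ f × RowSums≤ f as ds

rowSums≤? : ∀ {n} f (as ds : Vec ℕ n) → Dec (RowSums≤ f as ds)
rowSums≤? f []       []       = yes tt
rowSums≤? f (a ∷ as) (d ∷ ds) = (_ ℕ.≤? f) ×-dec rowSums≤? f as ds

RowSums≤⇒sumFrom≤ : ∀ {n f} {as ds : Vec ℕ n} → RowSums≤ f as ds →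
                    ∀ j → sumFrom j (λ l → lookup as j ℕ.∸ lookup ds l) ℕ.≤ f
RowSums≤⇒sumFrom≤ {f = f} {a ∷ as} {ds@(_ ∷ _)} (row≤f , _) zero = subst (ℕ._≤ f) (cong sum row) row≤f
  where
  row : map (a ℕ.∸_) ds ≡ tabulate (λ l → a ℕ.∸ lookup ds l)
  row = sym (trans (tabulate-∘ (a ℕ.∸_) (lookup ds)) (cong (map (a ℕ.∸_)) (tabulate∘lookup ds)))
RowSums≤⇒sumFrom≤ {f = f} {_ ∷ as} {d ∷ ds} (_ , rows≤f) (suc j) =
  subst (ℕ._≤ f) (sym (sumFrom-suc j (λ l → lookup as j ℕ.∸ lookup (d ∷ ds) l))) (RowSums≤⇒sumFrom≤ rows≤f j)

≤-via-lower-bound : ∀ {a a′ d d′ μ} → a ℕ.≤ 3 ℕ.* μ ℕ.+ 3 ℕ.* d → μ ℕ.≤ a′ ℕ.+ d′ →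
                    a ℕ.≤ 3 ℕ.* a′ ℕ.+ 3 ℕ.* d ℕ.+ 3 ℕ.* d′
≤-via-lower-bound {a} {a′} {d} {d′} {μ} a≤3μ+3d μ≤a′+d′ = begin
  a                                  ≤⟨ a≤3μ+3d ⟩
  3 ℕ.* μ ℕ.+ 3 ℕ.* d                ≤⟨ ℕ.+-monoˡ-≤ (3 ℕ.* d) (ℕ.*-monoʳ-≤ 3 μ≤a′+d′) ⟩
  3 ℕ.* (a′ ℕ.+ d′) ℕ.+ 3 ℕ.* d      ≡⟨ regroup a′ d′ d ⟩
  3 ℕ.* a′ ℕ.+ 3 ℕ.* d ℕ.+ 3 ℕ.* d′  ∎
  where
  open ℕ.≤-Reasoning
  regroup : ∀ x y z → 3 ℕ.* (x ℕ.+ y) ℕ.+ 3 ℕ.* z ≡ 3 ℕ.* x ℕ.+ 3 ℕ.* z ℕ.+ 3 ℕ.* y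
  regroup = solve-∀

module Scaled (n : ℕ) where

  scale : ℕ → ℚ
  scale a = + a / ℕ.suc n

  scaled : ∀ {k} → Vec ℕ k → Fin k → ℚ
  scaled v i = scale (lookup v i)

  scaled-excess : ∀ {k} → Vec ℕ k → Vec ℕ k → Fin k → Fin k → ℚ
  scaled-excess as ds j l = scale (lookup as j ℕ.∸ lookup ds l)

  scale-0 : scale 0 ≡ 0ℚ
  scale-0 = 0/n≡0 (ℕ.suc n)

  scale-+ : ∀ a b → scale (a ℕ.+ b) ≡ scale a + scale b
  scale-+ a b = /-distribʳ-+ (+ a) (+ b) n

  scale-* : ∀ k a → (+ k / 1) * scale a ≡ scale (k ℕ.* a)
  scale-* k a = trans (/1-*-/ (+ k) (+ a) n) (cong (_/ ℕ.suc n) (sym (ℤ.pos-* k a)))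

  scale-mono-≤ : ∀ {a b} → a ℕ.≤ b → scale a ≤ scale b
  scale-mono-≤ {a} {b} a≤b = /-mono-≤ {a} {b} n n (ℕ.*-monoˡ-≤ (ℕ.suc n) a≤b)

  scale-nonNeg : ∀ a → 0ℚ ≤ scale a
  scale-nonNeg a = subst (_≤ scale a) scale-0 (scale-mono-≤ {0} {a} ℕ.z≤n)

  scale-≤-1 : ∀ {a} → a ℕ.≤ ℕ.suc n → scale a ≤ 1ℚ
  scale-≤-1 {a} a≤D = /-mono-≤ {a} {1} n 0 (subst₂ ℕ._≤_ (sym (ℕ.*-identityʳ a)) (sym (ℕ.*-identityˡ _)) a≤D)

  scale-∸ : ∀ a b → scale a - scale b ≤ scale (a ℕ.∸ b)
  scale-∸ a b = begin
    scale a - scale b                   ≤⟨ +-monoˡ-≤ (- scale b) (scale-mono-≤ {a} a≤a∸b+b) ⟩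
    scale (a ℕ.∸ b ℕ.+ b) - scale b     ≡⟨ cong (_- scale b) (scale-+ (a ℕ.∸ b) b) ⟩
    scale (a ℕ.∸ b) + scale b - scale b ≡⟨ //-rightDividesʳ (scale b) (scale (a ℕ.∸ b)) ⟩
    scale (a ℕ.∸ b)                     ∎
    where
    open ≤-Reasoning
    a≤a∸b+b : a ℕ.≤ a ℕ.∸ b ℕ.+ b
    a≤a∸b+b = subst (a ℕ.≤_) (ℕ.+-comm b (a ℕ.∸ b)) (ℕ.m≤n+m∸n a b)

  sumFin-scale : ∀ {k} (g : Fin k → ℚ) (h : Fin k → ℕ) → (∀ i → g i ≡ scale (h i)) →
                 sumFin g ≡ scale (sum (tabulate h))
  sumFin-scale {ℕ.zero}  g h g≗h = sym scale-0
  sumFin-scale {ℕ.suc k} g h g≗h = begin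
    g zero + sumFin (g ∘ suc)                     ≡⟨ cong₂ _+_ (g≗h zero) (sumFin-scale (g ∘ suc) (h ∘ suc) (g≗h ∘ suc)) ⟩
    scale (h zero) + scale (sum (tabulate (h ∘ suc))) ≡⟨ scale-+ (h zero) _ ⟨
    scale (sum (tabulate h))                      ∎
    where open ≡-Reasoning

  sumFin-scaled : ∀ {k} (v : Vec ℕ k) → sumFin (scaled v) ≡ scale (sum v)
  sumFin-scaled v = trans (sumFin-scale _ (lookup v) (λ _ → refl)) (cong scale (cong sum (tabulate∘lookup v)))

  scale-if : ∀ b a → (if b then scale a else 0ℚ) ≡ scale (if b then a else 0)
  scale-if true  a = refl
  scale-if false a = sym scale-0

  3*-scale-+ : ∀ a b c → 3ℚ * scale a + 3ℚ * scale b + 3ℚ * scale c ≡ scale (3 ℕ.* a ℕ.+ 3 ℕ.* b ℕ.+ 3 ℕ.* c)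
  3*-scale-+ a b c = begin
    3ℚ * scale a + 3ℚ * scale b + 3ℚ * scale c                ≡⟨ cong₂ _+_ (cong₂ _+_ (scale-* 3 a) (scale-* 3 b)) (scale-* 3 c) ⟩
    scale (3 ℕ.* a) + scale (3 ℕ.* b) + scale (3 ℕ.* c)       ≡⟨ cong (_+ scale (3 ℕ.* c)) (scale-+ (3 ℕ.* a) (3 ℕ.* b)) ⟨
    scale (3 ℕ.* a ℕ.+ 3 ℕ.* b) + scale (3 ℕ.* c)            ≡⟨ scale-+ (3 ℕ.* a ℕ.+ 3 ℕ.* b) (3 ℕ.* c) ⟨
    scale (3 ℕ.* a ℕ.+ 3 ℕ.* b ℕ.+ 3 ℕ.* c)                  ∎
    where open ≡-Reasoning

  scaled-feasible : ∀ {m} (as ds : Vec ℕ (ℕ.suc m)) (f μ : ℕ) →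
    f ℕ.+ sum ds ℕ.≤ ℕ.suc n →
    Linked ℕ._≤_ as →
    Pointwise (λ a d → a ℕ.≤ 3 ℕ.* μ ℕ.+ 3 ℕ.* d) as ds →
    Pointwise (λ a d → μ ℕ.≤ a ℕ.+ d) as ds →
    RowSums≤ f as ds →
    Feasible m (scaled as) (scaled ds) (scale f) (scaled-excess as ds)
  scaled-feasible as ds f μ budget sorted α≤3μ+3d μ≤α+d rows =
    budget′ , (λ j → scale-mono-≤ (linked-lookup sorted j)) , pairwise , (λ j l _ → scale-∸ (A j) (D l)) ,
    rows′ , scale-nonNeg ∘ A , scale-nonNeg ∘ D , scale-nonNeg f , (λ j l _ → scale-nonNeg (A j ℕ.∸ D l))
    where
    A D : Fin _ → ℕ
    A = lookup as
    D = lookup ds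

    budget′ : scale f + sumFin (scaled ds) ≤ 1ℚ
    budget′ = subst (_≤ 1ℚ) (trans (scale-+ f (sum ds)) (cong (_+_ (scale f)) (sym (sumFin-scaled ds))))
                (scale-≤-1 budget)

    pairwise : ∀ j l → scale (A j) ≤ 3ℚ * scale (A l) + 3ℚ * scale (D j) + 3ℚ * scale (D l)
    pairwise j l = subst (scale (A j) ≤_) (sym (3*-scale-+ (A l) (D j) (D l))) (scale-mono-≤
      (≤-via-lower-bound {A j} {A l} {D j} {D l} (Pointwise.lookup α≤3μ+3d j) (Pointwise.lookup μ≤α+d l)))

    rows′ : ∀ j → sumFin (λ l → if ⌊ j ≤? l ⌋ then scale (A j ℕ.∸ D l) else 0ℚ) ≤ scale f
    rows′ j = subst (_≤ scale f) (sym (sumFin-scale _ row λ l → scale-if ⌊ j ≤? l ⌋ (A j ℕ.∸ D l)))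
      (scale-mono-≤ (RowSums≤⇒sumFrom≤ rows j))
      where
      row : Fin _ → ℕ
      row l = if ⌊ j ≤? l ⌋ then A j ℕ.∸ D l else 0

numerators-α : Vec ℕ 700
numerators-α =
    805386859 ∷ 806405137 ∷ 807429010 ∷ 808458519 ∷ 809493705 ∷ 810534610 ∷ 811580485 ∷ 812631011 ∷
    813687363 ∷ 814749583 ∷ 815817716 ∷ 816891805 ∷ 817971894 ∷ 819058028 ∷ 820150253 ∷ 821248614 ∷
    822353157 ∷ 823463929 ∷ 824580976 ∷ 825702388 ∷ 826829990 ∷ 827963986 ∷ 829104426 ∷ 830251358 ∷
    831404832 ∷ 832564896 ∷ 833731602 ∷ 834905001 ∷ 836085143 ∷ 837272081 ∷ 838465682 ∷ 839664058 ∷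
    840869361 ∷ 842081645 ∷ 843300964 ∷ 844527371 ∷ 845760922 ∷ 847001674 ∷ 848249681 ∷ 849505000 ∷
    850767690 ∷ 852037807 ∷ 853313240 ∷ 854595854 ∷ 855886043 ∷ 857183866 ∷ 858489384 ∷ 859802658 ∷
    861123748 ∷ 862452718 ∷ 863789630 ∷ 865134547 ∷ 866486941 ∷ 867845338 ∷ 869211901 ∷ 870586696 ∷
    871969790 ∷ 873361249 ∷ 874761142 ∷ 876169536 ∷ 877586500 ∷ 879012104 ∷ 880446274 ∷ 881886431 ∷
    883335405 ∷ 884793268 ∷ 886260093 ∷ 887735955 ∷ 889220926 ∷ 890715083 ∷ 892218501 ∷ 893731258 ∷
    895252423 ∷ 896780907 ∷ 898318924 ∷ 899866553 ∷ 901423876 ∷ 902990972 ∷ 904567924 ∷ 906154815 ∷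
    907751729 ∷ 909358519 ∷ 910972319 ∷ 912596355 ∷ 914230713 ∷ 915875481 ∷ 917530747 ∷ 919196602 ∷
    920873135 ∷ 922560438 ∷ 924257919 ∷ 925963370 ∷ 927679823 ∷ 929407375 ∷ 931146120 ∷ 932896156 ∷
    934657580 ∷ 936430492 ∷ 938214992 ∷ 940008644 ∷ 941812665 ∷ 943628529 ∷ 945456338 ∷ 947296200 ∷
    949148219 ∷ 951012503 ∷ 952889161 ∷ 954776429 ∷ 956673939 ∷ 958584100 ∷ 960507023 ∷ 962442823 ∷
    964391614 ∷ 966353515 ∷ 968328641 ∷ 970314501 ∷ 972311918 ∷ 974322862 ∷ 976347455 ∷ 978385820 ∷
    980438083 ∷ 982504372 ∷ 984584812 ∷ 986674806 ∷ 988779094 ∷ 990897861 ∷ 993031240 ∷ 995179366 ∷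
    997342376 ∷ 999520406 ∷ 1001710319 ∷ 1003913671 ∷ 1006132396 ∷ 1008366636 ∷ 1010616537 ∷
    1012882245 ∷ 1015163909 ∷ 1017458541 ∷ 1019767109 ∷ 1022092011 ∷ 1024433402 ∷ 1026791438 ∷
    1029166276 ∷ 1031558078 ∷ 1033962690 ∷ 1036383095 ∷ 1038820871 ∷ 1041276186 ∷ 1043749206 ∷
    1046240105 ∷ 1048748293 ∷ 1051269358 ∷ 1053808736 ∷ 1056366524 ∷ 1058936759 ∷ 1061519531 ∷
    1064114934 ∷ 1066718754 ∷ 1069333261 ∷ 1071960616 ∷ 1074600913 ∷ 1077254248 ∷ 1079920719 ∷
    1082597952 ∷ 1085284299 ∷ 1087984011 ∷ 1090697188 ∷ 1093423931 ∷ 1096164342 ∷ 1098917488 ∷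
    1101678587 ∷ 1104453596 ∷ 1107242620 ∷ 1110045766 ∷ 1112863141 ∷ 1115694814 ∷ 1118533732 ∷
    1121387135 ∷ 1124255133 ∷ 1127137838 ∷ 1130035365 ∷ 1132947827 ∷ 1135868123 ∷ 1138803183 ∷
    1141753450 ∷ 1144719043 ∷ 1147700082 ∷ 1150696539 ∷ 1153700969 ∷ 1156721129 ∷ 1159757142 ∷
    1162809135 ∷ 1165877233 ∷ 1168960323 ∷ 1172052810 ∷ 1175161704 ∷ 1178287134 ∷ 1181429233 ∷
    1184588134 ∷ 1187760962 ∷ 1190945307 ∷ 1194146773 ∷ 1197365498 ∷ 1200601621 ∷ 1203855284 ∷
    1207120805 ∷ 1210401025 ∷ 1213699120 ∷ 1217015238 ∷ 1220349526 ∷ 1223701714 ∷ 1227063532 ∷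
    1230443872 ∷ 1233842888 ∷ 1237260735 ∷ 1240697571 ∷ 1244148771 ∷ 1247614366 ∷ 1251099323 ∷
    1254603802 ∷ 1258127970 ∷ 1261671894 ∷ 1265225899 ∷ 1268799984 ∷ 1272394318 ∷ 1276009074 ∷
    1279644428 ∷ 1283294026 ∷ 1286960581 ∷ 1290648147 ∷ 1294356906 ∷ 1298087041 ∷ 1301835390 ∷
    1305597920 ∷ 1309382262 ∷ 1313188605 ∷ 1317017144 ∷ 1320867541 ∷ 1324729727 ∷ 1328614565 ∷
    1332522254 ∷ 1336452999 ∷ 1340407002 ∷ 1344374595 ∷ 1348363837 ∷ 1352376825 ∷ 1356413771 ∷
    1360474890 ∷ 1364551390 ∷ 1368649142 ∷ 1372771579 ∷ 1376918925 ∷ 1381091407 ∷ 1385280551 ∷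
    1389491131 ∷ 1393727384 ∷ 1397989547 ∷ 1402277859 ∷ 1406583560 ∷ 1410911509 ∷ 1415266174 ∷
    1419647803 ∷ 1424056647 ∷ 1428482896 ∷ 1432932999 ∷ 1437410914 ∷ 1441916905 ∷ 1446451235 ∷
    1451001657 ∷ 1455578949 ∷ 1460185211 ∷ 1464820720 ∷ 1469484895 ∷ 1474164783 ∷ 1478874575 ∷
    1483614557 ∷ 1488385022 ∷ 1493181828 ∷ 1497998544 ∷ 1502846436 ∷ 1507725807 ∷ 1512636966 ∷
    1517571041 ∷ 1522530423 ∷ 1527522326 ∷ 1532547071 ∷ 1537604982 ∷ 1542680717 ∷ 1547788931 ∷
    1552931087 ∷ 1558107524 ∷ 1563312768 ∷ 1568541239 ∷ 1573804800 ∷ 1579103807 ∷ 1584438617 ∷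
    1589795549 ∷ 1595184686 ∷ 1600610484 ∷ 1606073319 ∷ 1611568589 ∷ 1617087660 ∷ 1622644662 ∷
    1628239988 ∷ 1633874037 ∷ 1639530953 ∷ 1645223769 ∷ 1650956256 ∷ 1656728831 ∷ 1662533266 ∷
    1668366716 ∷ 1674241247 ∷ 1680157294 ∷ 1686114145 ∷ 1692093273 ∷ 1698114957 ∷ 1704179653 ∷
    1710287824 ∷ 1716423776 ∷ 1722597962 ∷ 1728816727 ∷ 1735080556 ∷ 1741379024 ∷ 1747711311 ∷
    1754089820 ∷ 1760515057 ∷ 1766981582 ∷ 1773477837 ∷ 1780022036 ∷ 1786614710 ∷ 1793255082 ∷
    1799921458 ∷ 1806637583 ∷ 1813404016 ∷ 1820221324 ∷ 1827066894 ∷ 1833961486 ∷ 1840908310 ∷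
    1847907961 ∷ 1854939398 ∷ 1862019320 ∷ 1869153493 ∷ 1876342545 ∷ 1883566440 ∷ 1890838897 ∷
    1898167730 ∷ 1905553597 ∷ 1912976848 ∷ 1920449414 ∷ 1927980588 ∷ 1935571063 ∷ 1943200631 ∷
    1950881266 ∷ 1958622858 ∷ 1966426136 ∷ 1974268265 ∷ 1982165338 ∷ 1990125841 ∷ 1998150542 ∷
    2006213066 ∷ 2014335387 ∷ 2022523742 ∷ 2030778941 ∷ 2039070083 ∷ 2047426927 ∷ 2055852553 ∷
    2064345786 ∷ 2072876140 ∷ 2081477286 ∷ 2090150108 ∷ 2098886313 ∷ 2107668264 ∷ 2116524013 ∷
    2125454494 ∷ 2134442985 ∷ 2143487235 ∷ 2152608457 ∷ 2161807639 ∷ 2171058207 ∷ 2180376053 ∷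
    2189774226 ∷ 2199237006 ∷ 2208757513 ∷ 2218360806 ∷ 2228031677 ∷ 2237761073 ∷ 2247575814 ∷
    2257460885 ∷ 2267405646 ∷ 2277438415 ∷ 2287544035 ∷ 2297710898 ∷ 2307968535 ∷ 2318301308 ∷
    2328697278 ∷ 2339186906 ∷ 2349753698 ∷ 2360386068 ∷ 2371115095 ∷ 2381923053 ∷ 2392799414 ∷
    2403775558 ∷ 2414832118 ∷ 2425960377 ∷ 2437191675 ∷ 2448504584 ∷ 2459892978 ∷ 2471387805 ∷
    2482965134 ∷ 2494622247 ∷ 2506389333 ∷ 2518239493 ∷ 2530174277 ∷ 2542222726 ∷ 2554354490 ∷
    2566576281 ∷ 2578915590 ∷ 2591338108 ∷ 2603856650 ∷ 2616496731 ∷ 2629219556 ∷ 2642045017 ∷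
    2654996218 ∷ 2668029325 ∷ 2681172327 ∷ 2694445457 ∷ 2707799269 ∷ 2721270907 ∷ 2734877262 ∷
    2748562674 ∷ 2762374547 ∷ 2776325933 ∷ 2790354340 ∷ 2804518575 ∷ 2818827344 ∷ 2833210671 ∷
    2847739956 ∷ 2862415044 ∷ 2877169761 ∷ 2892077376 ∷ 2907130196 ∷ 2922271499 ∷ 2937571350 ∷
    2953015484 ∷ 2968557671 ∷ 2984264325 ∷ 3000114019 ∷ 3016072073 ∷ 3032200800 ∷ 3048471004 ∷
    3064860633 ∷ 3081427447 ∷ 3098133860 ∷ 3114971544 ∷ 3131993247 ∷ 3149152365 ∷ 3166455081 ∷
    3183939864 ∷ 3201527391 ∷ 3219239211 ∷ 3237115944 ∷ 3255092283 ∷ 3273203730 ∷ 3291485718 ∷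
    3309865593 ∷ 3328390326 ∷ 3347091486 ∷ 3365890419 ∷ 3384842733 ∷ 3403977633 ∷ 3423212001 ∷
    3442606869 ∷ 3462190770 ∷ 3481877865 ∷ 3501730971 ∷ 3521779866 ∷ 3541937964 ∷ 3562265751 ∷
    3582796407 ∷ 3603444846 ∷ 3624264561 ∷ 3645294573 ∷ 3666453828 ∷ 3687783576 ∷ 3709331418 ∷
    3731023188 ∷ 3752881983 ∷ 3774967059 ∷ 3797214369 ∷ 3819622197 ∷ 3842264904 ∷ 3865092210 ∷
    3888070086 ∷ 3911291886 ∷ 3934725186 ∷ 3958295226 ∷ 3982118706 ∷ 4006185681 ∷ 4030371177 ∷
    4054820133 ∷ 4079537166 ∷ 4104375804 ∷ 4129475316 ∷ 4154853714 ∷ 4180391595 ∷ 4206168129 ∷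
    4232234940 ∷ 4258505979 ∷ 4284987474 ∷ 4311771270 ∷ 4338811743 ∷ 4366027722 ∷ 4393558701 ∷
    4421407470 ∷ 4449389157 ∷ 4477699263 ∷ 4506344007 ∷ 4535178591 ∷ 4564301649 ∷ 4593773907 ∷
    4623509691 ∷ 4653481542 ∷ 4683818016 ∷ 4714503657 ∷ 4745362323 ∷ 4776601959 ∷ 4808230146 ∷
    4840075893 ∷ 4872260052 ∷ 4904850579 ∷ 4937763252 ∷ 4970935911 ∷ 5004533859 ∷ 5038565889 ∷
    5072783307 ∷ 5107436679 ∷ 5142544818 ∷ 5177967456 ∷ 5213727411 ∷ 5249964165 ∷ 5286665595 ∷
    5323586721 ∷ 5361008133 ∷ 5398940769 ∷ 5437209402 ∷ 5475875370 ∷ 5515078365 ∷ 5554805229 ∷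
    5594779845 ∷ 5635319076 ∷ 5676435789 ∷ 5717953122 ∷ 5759899197 ∷ 5802453186 ∷ 5845629309 ∷
    5889074268 ∷ 5933143521 ∷ 5977868565 ∷ 6023122056 ∷ 6068790438 ∷ 6115150770 ∷ 6162219972 ∷
    6209702178 ∷ 6257790858 ∷ 6306628581 ∷ 6356214891 ∷ 6406132368 ∷ 6456842184 ∷ 6508364661 ∷
    6560551335 ∷ 6613245285 ∷ 6666800247 ∷ 6721238955 ∷ 6776259180 ∷ 6831972003 ∷ 6888622749 ∷
    6946236942 ∷ 7004354169 ∷ 7063357731 ∷ 7123385658 ∷ 7184466708 ∷ 7245979893 ∷ 7308580206 ∷
    7372302384 ∷ 7437083307 ∷ 7502429301 ∷ 7568972109 ∷ 7636747191 ∷ 7705609485 ∷ 7775169585 ∷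
    7846047111 ∷ 7918282446 ∷ 7991669490 ∷ 8065873623 ∷ 8141532741 ∷ 8218693032 ∷ 8297118531 ∷
    8376458151 ∷ 8457410361 ∷ 8540028255 ∷ 8624091261 ∷ 8709130887 ∷ 8795964597 ∷ 8884653732 ∷
    8975057766 ∷ 9066449295 ∷ 9159845025 ∷ 9255316215 ∷ 9352893939 ∷ 9451394460 ∷ 9552143853 ∷
    9655225404 ∷ 9747422172 ∷ 9834227430 ∷ 9922714959 ∷ 10012937538 ∷ 10104950250 ∷ 10198810602 ∷
    10294578687 ∷ 10392317310 ∷ 10492092153 ∷ 10593971952 ∷ 10698028668 ∷ 10804337694 ∷
    10912978059 ∷ 11024032656 ∷ 11137588479 ∷ 11253736905 ∷ 11372573949 ∷ 11494200594 ∷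
    11618723112 ∷ 11746253424 ∷ 11876909475 ∷ 12010815678 ∷ 12148103349 ∷ 12288911220 ∷
    12433385961 ∷ 12581682783 ∷ 12733966083 ∷ 12890410125 ∷ 13051199838 ∷ 13216531629 ∷
    13386614337 ∷ 13561670223 ∷ 13741936107 ∷ 13927664592 ∷ 14119125435 ∷ 14316607062 ∷
    14520418230 ∷ 14730889890 ∷ 14948377275 ∷ 15173262189 ∷ 15405955608 ∷ 15646900563 ∷
    15896575413 ∷ 16155497475 ∷ 16424227194 ∷ 16703372790 ∷ 16993595595 ∷ 17295616077 ∷
    17610220743 ∷ 17938270053 ∷ 18280707489 ∷ 18638570037 ∷ 19013000295 ∷ 19405260567 ∷
    19816749282 ∷ 20249020254 ∷ 20703805341 ∷ 21183041238 ∷ 21688901352 ∷ 22223833887 ∷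
    22790607645 ∷ 23392367436 ∷ 24032701572 ∷ 24715724652 ∷ 25446179889 ∷ 26229566664 ∷
    27072300924 ∷ 27981918855 ∷ 28967338281 ∷ 30039198006 ∷ 31210304001 ∷ 32236896246 ∷
    32236896246 ∷ 32236896246 ∷ 32236896246 ∷ 32236896246 ∷ 32236896246 ∷ 32236896246 ∷
    32236896246 ∷ 32236896246 ∷ 32236896246 ∷ 32236896246 ∷ 32236896246 ∷ 32236896246 ∷
    32236896246 ∷ 32236896246 ∷ 32236896246 ∷ 32236896246 ∷ []

numerators-d : Vec ℕ 700
numerators-d =
    248388860 ∷ 247370582 ∷ 246346709 ∷ 245317200 ∷ 244282014 ∷ 243241109 ∷ 242195234 ∷ 241144708 ∷
    240088356 ∷ 239026136 ∷ 237958003 ∷ 236883914 ∷ 235803825 ∷ 234717691 ∷ 233625466 ∷ 232527105 ∷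
    231422562 ∷ 230311790 ∷ 229194743 ∷ 228073331 ∷ 226945729 ∷ 225811733 ∷ 224671293 ∷ 223524361 ∷
    222370887 ∷ 221210823 ∷ 220044117 ∷ 218870718 ∷ 217690576 ∷ 216503638 ∷ 215310037 ∷ 214111661 ∷
    212906358 ∷ 211694074 ∷ 210474755 ∷ 209248348 ∷ 208014797 ∷ 206774045 ∷ 205526038 ∷ 204270719 ∷
    203008029 ∷ 201737912 ∷ 200462479 ∷ 199179865 ∷ 197889676 ∷ 196591853 ∷ 195286335 ∷ 193973061 ∷
    192651971 ∷ 191323001 ∷ 189986089 ∷ 188641172 ∷ 187288778 ∷ 185930381 ∷ 184563818 ∷ 183189023 ∷
    181805929 ∷ 180414470 ∷ 179014577 ∷ 177606183 ∷ 176189219 ∷ 174763615 ∷ 173329445 ∷ 171889288 ∷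
    170440314 ∷ 168982451 ∷ 167515626 ∷ 166039764 ∷ 164554793 ∷ 163060636 ∷ 161557218 ∷ 160044461 ∷
    158523296 ∷ 156994812 ∷ 155456795 ∷ 153909166 ∷ 152351843 ∷ 150784747 ∷ 149207795 ∷ 147620904 ∷
    146023990 ∷ 144417201 ∷ 142803400 ∷ 141179365 ∷ 139545006 ∷ 137900239 ∷ 136244972 ∷ 134579118 ∷
    132902584 ∷ 131215281 ∷ 129517800 ∷ 127812349 ∷ 126095896 ∷ 124368344 ∷ 122629599 ∷ 120879563 ∷
    119118139 ∷ 117345227 ∷ 115560728 ∷ 113767075 ∷ 111963054 ∷ 110147191 ∷ 108319381 ∷ 106479519 ∷
    104627500 ∷ 102763216 ∷ 100886558 ∷ 98999290 ∷ 97101780 ∷ 95191620 ∷ 93268696 ∷ 91332897 ∷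
    89384105 ∷ 87422205 ∷ 85447078 ∷ 83461219 ∷ 81463801 ∷ 79452857 ∷ 77428265 ∷ 75389899 ∷
    73337636 ∷ 71271348 ∷ 69190907 ∷ 67100914 ∷ 64996626 ∷ 62877858 ∷ 60744479 ∷ 58596353 ∷
    56433344 ∷ 54255314 ∷ 52065401 ∷ 49862048 ∷ 47643323 ∷ 45409083 ∷ 43159182 ∷ 40893474 ∷
    38611810 ∷ 36317178 ∷ 34008610 ∷ 31683708 ∷ 29342317 ∷ 26984282 ∷ 24609443 ∷ 22217641 ∷
    19813029 ∷ 17392624 ∷ 14954848 ∷ 12499534 ∷ 10026513 ∷ 7535615 ∷ 5027426 ∷ 2506361 ∷ 0 ∷ 0 ∷
    0 ∷ 0 ∷ 0 ∷ 0 ∷ 0 ∷ 0 ∷ 0 ∷ 0 ∷ 0 ∷ 0 ∷ 0 ∷ 0 ∷ 0 ∷ 0 ∷ 0 ∷ 0 ∷ 0 ∷ 0 ∷ 0 ∷ 0 ∷ 0 ∷ 0 ∷ 0 ∷ 0 ∷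
    0 ∷ 0 ∷ 0 ∷ 0 ∷ 0 ∷ 0 ∷ 0 ∷ 0 ∷ 0 ∷ 0 ∷ 0 ∷ 0 ∷ 0 ∷ 0 ∷ 0 ∷ 0 ∷ 0 ∷ 0 ∷ 0 ∷ 0 ∷ 0 ∷ 0 ∷ 0 ∷ 0 ∷
    0 ∷ 0 ∷ 0 ∷ 0 ∷ 0 ∷ 0 ∷ 0 ∷ 0 ∷ 0 ∷ 0 ∷ 0 ∷ 0 ∷ 0 ∷ 0 ∷ 0 ∷ 0 ∷ 0 ∷ 0 ∷ 0 ∷ 0 ∷ 0 ∷ 0 ∷ 0 ∷ 0 ∷
    0 ∷ 0 ∷ 0 ∷ 0 ∷ 0 ∷ 0 ∷ 0 ∷ 0 ∷ 0 ∷ 0 ∷ 0 ∷ 0 ∷ 0 ∷ 0 ∷ 0 ∷ 0 ∷ 0 ∷ 0 ∷ 0 ∷ 0 ∷ 0 ∷ 0 ∷ 0 ∷ 0 ∷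
    0 ∷ 0 ∷ 0 ∷ 0 ∷ 0 ∷ 0 ∷ 0 ∷ 0 ∷ 0 ∷ 0 ∷ 0 ∷ 0 ∷ 0 ∷ 0 ∷ 0 ∷ 0 ∷ 0 ∷ 0 ∷ 0 ∷ 0 ∷ 0 ∷ 0 ∷ 0 ∷ 0 ∷
    0 ∷ 0 ∷ 0 ∷ 0 ∷ 0 ∷ 0 ∷ 0 ∷ 0 ∷ 0 ∷ 0 ∷ 0 ∷ 0 ∷ 0 ∷ 0 ∷ 0 ∷ 0 ∷ 0 ∷ 0 ∷ 0 ∷ 0 ∷ 0 ∷ 0 ∷ 0 ∷ 0 ∷
    0 ∷ 0 ∷ 0 ∷ 0 ∷ 0 ∷ 0 ∷ 0 ∷ 0 ∷ 0 ∷ 0 ∷ 0 ∷ 0 ∷ 0 ∷ 0 ∷ 0 ∷ 0 ∷ 0 ∷ 0 ∷ 0 ∷ 0 ∷ 0 ∷ 0 ∷ 0 ∷ 0 ∷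
    0 ∷ 0 ∷ 0 ∷ 0 ∷ 0 ∷ 0 ∷ 0 ∷ 0 ∷ 0 ∷ 0 ∷ 0 ∷ 0 ∷ 0 ∷ 0 ∷ 0 ∷ 0 ∷ 0 ∷ 0 ∷ 0 ∷ 0 ∷ 0 ∷ 0 ∷ 0 ∷ 0 ∷
    0 ∷ 0 ∷ 0 ∷ 0 ∷ 0 ∷ 0 ∷ 0 ∷ 0 ∷ 0 ∷ 0 ∷ 0 ∷ 0 ∷ 0 ∷ 0 ∷ 0 ∷ 0 ∷ 0 ∷ 0 ∷ 0 ∷ 0 ∷ 0 ∷ 0 ∷ 0 ∷ 0 ∷
    0 ∷ 0 ∷ 0 ∷ 0 ∷ 0 ∷ 0 ∷ 0 ∷ 0 ∷ 0 ∷ 0 ∷ 0 ∷ 0 ∷ 0 ∷ 0 ∷ 0 ∷ 0 ∷ 0 ∷ 0 ∷ 0 ∷ 0 ∷ 0 ∷ 0 ∷ 0 ∷ 0 ∷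
    0 ∷ 0 ∷ 0 ∷ 0 ∷ 0 ∷ 0 ∷ 0 ∷ 0 ∷ 0 ∷ 0 ∷ 0 ∷ 0 ∷ 0 ∷ 0 ∷ 0 ∷ 0 ∷ 0 ∷ 0 ∷ 0 ∷ 0 ∷ 0 ∷ 0 ∷ 0 ∷ 0 ∷
    0 ∷ 0 ∷ 0 ∷ 0 ∷ 0 ∷ 0 ∷ 0 ∷ 0 ∷ 0 ∷ 0 ∷ 0 ∷ 0 ∷ 0 ∷ 0 ∷ 0 ∷ 0 ∷ 0 ∷ 0 ∷ 0 ∷ 0 ∷ 0 ∷ 0 ∷ 0 ∷ 0 ∷
    0 ∷ 0 ∷ 0 ∷ 0 ∷ 0 ∷ 0 ∷ 0 ∷ 0 ∷ 0 ∷ 0 ∷ 0 ∷ 0 ∷ 0 ∷ 0 ∷ 1709413 ∷ 7537674 ∷ 13400183 ∷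
    19304123 ∷ 25263034 ∷ 31255147 ∷ 37292296 ∷ 43386292 ∷ 49512917 ∷ 55687828 ∷ 61921548 ∷
    68187859 ∷ 74505297 ∷ 80883597 ∷ 87295053 ∷ 93760009 ∷ 100287976 ∷ 106850341 ∷ 113468043 ∷
    120151008 ∷ 126870374 ∷ 133646303 ∷ 140489855 ∷ 147372668 ∷ 154312573 ∷ 161322577 ∷ 168375662 ∷
    175485578 ∷ 182668192 ∷ 189898782 ∷ 197185047 ∷ 204546739 ∷ 211962509 ∷ 219431785 ∷ 226979354 ∷
    234588456 ∷ 242247748 ∷ 249988348 ∷ 257799448 ∷ 265656128 ∷ 273597288 ∷ 281619613 ∷ 289681445 ∷
    297831097 ∷ 306070108 ∷ 314349654 ∷ 322716158 ∷ 331175624 ∷ 339688251 ∷ 348280429 ∷ 356969366 ∷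
    365726379 ∷ 374553544 ∷ 383481476 ∷ 392494967 ∷ 401566960 ∷ 410743953 ∷ 420026876 ∷ 429354105 ∷
    438790807 ∷ 448339055 ∷ 457950583 ∷ 467658269 ∷ 477482355 ∷ 487394283 ∷ 497384900 ∷ 507497058 ∷
    517725605 ∷ 528011827 ∷ 538425039 ∷ 548967768 ∷ 559583017 ∷ 570311070 ∷ 581174579 ∷ 592145470 ∷
    603203023 ∷ 614402339 ∷ 625746349 ∷ 637152155 ∷ 648703279 ∷ 660405992 ∷ 672213538 ∷ 684133523 ∷
    696212441 ∷ 708446251 ∷ 720753293 ∷ 733227097 ∷ 745871309 ∷ 758627520 ∷ 771516176 ∷ 784583841 ∷
    797826129 ∷ 811151001 ∷ 824664078 ∷ 838369649 ∷ 852208760 ∷ 866190785 ∷ 880375448 ∷ 894767489 ∷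
    909249142 ∷ 923938893 ∷ 938847241 ∷ 953931738 ∷ 969154532 ∷ 984607976 ∷ 1000297710 ∷
    1016125112 ∷ 1032154672 ∷ 1048433913 ∷ 1064962683 ∷ 1081601842 ∷ 1098505114 ∷ 1115679273 ∷
    1133074831 ∷ 1150639481 ∷ 1168491135 ∷ 1186637371 ∷ 1204977446 ∷ 1223548387 ∷ 1242431969 ∷
    1261636700 ∷ 1281009109 ∷ 1300676963 ∷ 1320686272 ∷ 1341046622 ∷ 1361551017 ∷ 1382417788 ∷
    1403658514 ∷ 1425252155 ∷ 1447034153 ∷ 1469215089 ∷ 1491806783 ∷ 1514760881 ∷ 1537947581 ∷
    1561573423 ∷ 1585651868 ∷ 1610114216 ∷ 1634848927 ∷ 1660068633 ∷ 1685788730 ∷ 1711930563 ∷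
    1738377103 ∷ 1765361173 ∷ 1792900471 ∷ 1820921473 ∷ 1849268015 ∷ 1878212585 ∷ 1907775630 ∷
    1937910308 ∷ 1968374151 ∷ 1999506061 ∷ 2031329791 ∷ 2063855699 ∷ 2096689206 ∷ 2130272337 ∷
    2164632854 ∷ 2195365110 ∷ 2224300196 ∷ 2253796039 ∷ 2283870232 ∷ 2314541136 ∷ 2345827920 ∷
    2377750615 ∷ 2410330156 ∷ 2443588437 ∷ 2477548370 ∷ 2512233942 ∷ 2547670284 ∷ 2583883739 ∷
    2620901938 ∷ 2658753879 ∷ 2697470021 ∷ 2737082369 ∷ 2777624584 ∷ 2819132090 ∷ 2861642194 ∷
    2905194211 ∷ 2949829612 ∷ 2995592169 ∷ 3042528126 ∷ 3090686373 ∷ 3140118647 ∷ 3190879747 ∷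
    3243027761 ∷ 3296624332 ∷ 3351734929 ∷ 3408429165 ∷ 3466781127 ∷ 3526869755 ∷ 3588779250 ∷
    3652599531 ∷ 3718426740 ∷ 3786363796 ∷ 3856521016 ∷ 3929016811 ∷ 4003978449 ∷ 4081542922 ∷
    4161857907 ∷ 4245082857 ∷ 4331390211 ∷ 4420966784 ∷ 4514015316 ∷ 4610756251 ∷ 4711429745 ∷
    4816297967 ∷ 4925647737 ∷ 5039793549 ∷ 5159081065 ∷ 5283891151 ∷ 5414644575 ∷ 5551807480 ∷
    5695897804 ∷ 5847492833 ∷ 6007238132 ∷ 6175858170 ∷ 6354169015 ∷ 6543093601 ∷ 6743680198 ∷
    6957124910 ∷ 7184799270 ∷ 7428284349 ∷ 7689413274 ∷ 7970324694 ∷ 8273530671 ∷ 8602003813 ∷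
    8959290388 ∷ 9349659053 ∷ 9691856468 ∷ 9691856468 ∷ 9691856468 ∷ 9691856468 ∷ 9691856468 ∷
    9691856468 ∷ 9691856468 ∷ 9691856468 ∷ 9691856468 ∷ 9691856468 ∷ 9691856468 ∷ 9691856468 ∷
    9691856468 ∷ 9691856468 ∷ 9691856468 ∷ 9691856468 ∷ 9691856468 ∷ []

numerator-f numerator-μ : ℕ
numerator-f = 387674258971
numerator-μ = 1053775614

numerators-budget : numerator-f ℕ.+ sum numerators-d ℕ.≤ 1000000000000
numerators-budget = from-yes (numerator-f ℕ.+ sum numerators-d ℕ.≤? 1000000000000)

numerators-α-sorted : Linked ℕ._≤_ numerators-α
numerators-α-sorted = from-yes (linked? ℕ._≤?_ numerators-α)

numerators-α≤3μ+3d : Pointwise (λ a d → a ℕ.≤ 3 ℕ.* numerator-μ ℕ.+ 3 ℕ.* d) numerators-α numerators-d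
numerators-α≤3μ+3d = from-yes (Pointwise.decidable (λ a d → a ℕ.≤? 3 ℕ.* numerator-μ ℕ.+ 3 ℕ.* d) numerators-α numerators-d)

numerators-μ≤α+d : Pointwise (λ a d → numerator-μ ℕ.≤ a ℕ.+ d) numerators-α numerators-d
numerators-μ≤α+d = from-yes (Pointwise.decidable (λ a d → numerator-μ ℕ.≤? a ℕ.+ d) numerators-α numerators-d)

numerators-rowSums≤ : RowSums≤ numerator-f numerators-α numerators-d
numerators-rowSums≤ = from-yes (rowSums≤? numerator-f numerators-α numerators-d)

numerators-objective : 161 ℕ.* 1000000000000 ℕ.≤ sum numerators-α ℕ.* 50
numerators-objective = from-yes (161 ℕ.* 1000000000000 ℕ.≤? sum numerators-α ℕ.* 50)

lemma4 : ∀ (ε : ℚ) → 0ℚ < ε →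
    Σ ℕ λ m → Σ (Fin (ℕ.suc m) → ℚ) λ α → Σ (Fin (ℕ.suc m) → ℚ) λ d → Σ ℚ λ f →
    Σ (Fin (ℕ.suc m) → Fin (ℕ.suc m) → ℚ) λ x →
    Feasible m α d f x × (c3220 - ε ≤ sumFin α)
lemma4 ε 0<ε =
  699 , scaled numerators-α , scaled numerators-d , scale numerator-f , scaled-excess numerators-α numerators-d ,
  scaled-feasible numerators-α numerators-d numerator-f numerator-μ
    numerators-budget numerators-α-sorted numerators-α≤3μ+3d numerators-μ≤α+d numerators-rowSums≤ ,
  ≤-trans (p-q≤p c3220 (<⇒≤ 0<ε)) objective
  where
  open Scaled 999999999999
  objective : c3220 ≤ sumFin (scaled numerators-α)
  objective = subst (c3220 ≤_) (sym (sumFin-scaled numerators-α))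
    (/-mono-≤ {161} {sum numerators-α} 49 999999999999 numerators-objective)
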